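{- Let $n\geq 3$ and let $K_{2,n}$ be the complete bipartite graph with parts of sizes $2$ and $n$ (so it has $n+2\geq 5$ vertices). Then $\gamma^{ID}(K_{2,n})=\gamma^{LD}(K_{2,n})=n$ and $\gamma^{L\text{ - }ID}(K_{2,n})=\gamma^{L\text{ - }LD}(K_{2,n})=2$.
   Context: Graphs are simple, connected, undirected. For a vertex $u$, $N[u]$ is its closed neighbourhood, and for a code (nonempty vertex subset) $C$, $I_C(u)=N[u]\cap C$. A code $C$ is a covering code if $I_C(u)\neq\emptyset$ for every vertex $u$. A code $C$ is: an identifying code if it is covering and $I_C(u)\neq I_C(v)$ for all distinct vertices $u,v$; a locating-dominating code if it is covering and $I_C(u)\neq I_C(v)$ for all distinct $u,v\notin C$; a local identifying code if it is covering and $I_C(u)\neq I_C(v)$ for all adjacent $u,v$; a local locating-dominating code if it is covering and $I_C(u)\neq I_C(v)$ for all adjacent $u,v\notin C$. $\gamma^{ID}(G),\gamma^{LD}(G),\gamma^{L\text{ - }ID}(G),\gamma^{L\text{ - }LD}(G)$ denote the minimum cardinalities of such codes in $G$, respectively. -}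

module Defs where

open import Data.Nat using (ℕ; suc; _+_; _≤_)
open import Data.Fin using (Fin; zero; suc; _≟_)
open import Data.Fin.Subset using (Subset; _∈_; ∣_∣; Nonempty; ⊥)
open import Data.Bool using (Bool; true; false; _∧_; _∨_; if_then_else_)
open import Data.Vec using (Vec; tabulate; lookup)
open import Data.Product using (Σ; _×_; _,_)
open import Relation.Nullary using (¬_; does)
open import Relation.Binary.PropositionalEquality using (_≡_; _≢_)

record Graph : Set where
  field
    order : ℕ
    adj   : Fin order → Fin order → Bool
    sym   : ∀ u v → adj u v ≡ adj v u
    irr   : ∀ u → adj u u ≡ false

open Graph public

N[_]_ : (G : Graph) → Fin (order G) → Subset (order G)
N[ G ] u = tabulate (λ w → does (w ≟ u) ∨ adj G u w)

I : (G : Graph) → Subset (order G) → Fin (order G) → Subset (order G)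
I G C u = tabulate (λ w → lookup (N[ G ] u) w ∧ lookup C w)

IsCode : (G : Graph) → Subset (order G) → Set
IsCode G C = Nonempty C

IsCovering : (G : Graph) → Subset (order G) → Set
IsCovering G C = IsCode G C × (∀ u → I G C u ≢ ⊥)

IsIdentifying : (G : Graph) → Subset (order G) → Set
IsIdentifying G C = IsCovering G C × (∀ u v → u ≢ v → I G C u ≢ I G C v)

IsLocatingDominating : (G : Graph) → Subset (order G) → Set
IsLocatingDominating G C = IsCovering G C ×
  (∀ u v → u ≢ v → ¬ (u ∈ C) → ¬ (v ∈ C) → I G C u ≢ I G C v)

IsLocalIdentifying : (G : Graph) → Subset (order G) → Set
IsLocalIdentifying G C = IsCovering G C ×
  (∀ u v → adj G u v ≡ true → I G C u ≢ I G C v)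

IsLocalLocatingDominating : (G : Graph) → Subset (order G) → Set
IsLocalLocatingDominating G C = IsCovering G C ×
  (∀ u v → adj G u v ≡ true → ¬ (u ∈ C) → ¬ (v ∈ C) → I G C u ≢ I G C v)

-- γ^P(G) = k : k is the minimum cardinality of a code with property P
IsMinCard : (G : Graph) → (Subset (order G) → Set) → ℕ → Set
IsMinCard G P k = Σ (Subset (order G)) (λ C → P C × ∣ C ∣ ≡ k)
                × (∀ C → P C → k ≤ ∣ C ∣)

-- K_{2,n}: vertices 0,1 form the part of size 2, vertices 2..n+1 the part
-- of size n; u,v adjacent iff they lie in different parts.
part : ∀ {n} → Fin (2 + n) → Bool
part zero = true
part (suc zero) = true
part (suc (suc _)) = false

xor : Bool → Bool → Bool
xor true b = if b then false else true
xor false b = b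

xor-sym : ∀ a b → xor a b ≡ xor b a
xor-sym true true = Relation.Binary.PropositionalEquality.refl
xor-sym true false = Relation.Binary.PropositionalEquality.refl
xor-sym false true = Relation.Binary.PropositionalEquality.refl
xor-sym false false = Relation.Binary.PropositionalEquality.refl

xor-irr : ∀ a → xor a a ≡ false
xor-irr true = Relation.Binary.PropositionalEquality.refl
xor-irr false = Relation.Binary.PropositionalEquality.refl

K2 : ℕ → Graph
K2 n = record
  { order = 2 + n
  ; adj = λ u v → xor (part u) (part v)
  ; sym = λ u v → xor-sym (part u) (part v)
  ; irr = λ u → xor-irr (part u)
  }

-- A vertex bᵢ of the n-part with bᵢ ∉ C has I_C(bᵢ) = C ∩ {a₀, a₁}, so two such
-- vertices are twins; a locating-dominating code therefore misses at most one of them,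
-- and must also meet {a₀, a₁}, since a₀, a₁ ∉ C gives I_C(a₀) = I_C(a₁) = C.  Hence
-- n ≤ ∣C∣, and {a₀} ∪ {b₁, …, b_{n-1}} is an identifying code of size n.  Every covering
-- code has at least two vertices, and {a₀, a₁} separates all adjacent pairs.
module Submission where

open import Defs hiding (sym)
open import Data.Nat using (ℕ; suc; _+_; _≤_; z≤n; s≤s)
open import Data.Nat.Properties using (≤-trans)
open import Data.Product using (∃; _×_; _,_; proj₁)
open import Data.Sum using (_⊎_; inj₁; inj₂)
open import Data.Bool using (Bool; true; false; _∧_; _∨_)
open import Data.Bool.Properties using (∧-identityʳ; ∨-identityʳ)
open import Data.Empty using (⊥-elim)
open import Data.Fin using (Fin; zero; suc; _≟_)
open import Data.Fin.Properties using (suc-injective)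
open import Data.Fin.Subset using (Subset; _∈_; ∣_∣; ⊥; ⊤; inside; outside)
open import Data.Fin.Subset.Properties using (∣p∣≤∣x∷p∣; ∣⊥∣≡0; ∣⊤∣≡n)
open import Data.Vec using (Vec; []; _∷_; lookup; tabulate; here; there)
open import Data.Vec.Properties using (lookup∘tabulate; tabulate∘lookup; tabulate-cong; lookup-replicate; []=⇒lookup)
open import Function using (_∘_)
open import Relation.Nullary using (¬_; does; yes; no)
open import Relation.Nullary.Decidable using (dec-true; dec-false)
open import Relation.Binary.PropositionalEquality

≗⇒≡ : ∀ {A : Set} {m} {xs ys : Vec A m} → (∀ i → lookup xs i ≡ lookup ys i) → xs ≡ ys
≗⇒≡ {xs = xs} {ys} eq = begin
  xs                ≡⟨ sym (tabulate∘lookup xs) ⟩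
  tabulate (lookup xs) ≡⟨ tabulate-cong eq ⟩
  tabulate (lookup ys) ≡⟨ tabulate∘lookup ys ⟩
  ys                ∎
  where open ≡-Reasoning

lookup-true-false⇒≢ : ∀ {m} {xs ys : Vec Bool m} i → lookup xs i ≡ true → lookup ys i ≡ false → xs ≢ ys
lookup-true-false⇒≢ i xᵢ yᵢ refl with trans (sym xᵢ) yᵢ
... | ()

lookup-true⇒≢⊥ : ∀ {m} {p : Subset m} i → lookup p i ≡ true → p ≢ ⊥
lookup-true⇒≢⊥ i pᵢ = lookup-true-false⇒≢ i pᵢ (lookup-replicate i false)

lookup-false⇒∉ : ∀ {m} {p : Subset m} {i} → lookup p i ≡ false → ¬ (i ∈ p)
lookup-false⇒∉ pᵢ i∈p with trans (sym ([]=⇒lookup i∈p)) pᵢ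
... | ()

-- The `∨ false` is the absent adjacency inside the n-part of K2.
⁅i⁆∩p≡∅ : ∀ {m} (p : Subset m) {i} → lookup p i ≡ false → ∀ k → (does (k ≟ i) ∨ false) ∧ lookup p k ≡ false
⁅i⁆∩p≡∅ p {i} pᵢ k with k ≟ i
... | yes refl = pᵢ
... | no _ = refl

allOutside⊎1≤∣p∣ : ∀ {m} (p : Subset m) → (∀ i → lookup p i ≡ false) ⊎ 1 ≤ ∣ p ∣
allOutside⊎1≤∣p∣ [] = inj₁ λ ()
allOutside⊎1≤∣p∣ (inside ∷ p) = inj₂ (s≤s z≤n)
allOutside⊎1≤∣p∣ (outside ∷ p) with allOutside⊎1≤∣p∣ p
... | inj₁ p≡∅ = inj₁ λ { zero → refl ; (suc i) → p≡∅ i }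
... | inj₂ 1≤∣p∣ = inj₂ 1≤∣p∣

outside⊎m≤∣p∣ : ∀ {m} (p : Subset m) → (∃ λ i → lookup p i ≡ false) ⊎ m ≤ ∣ p ∣
outside⊎m≤∣p∣ [] = inj₂ z≤n
outside⊎m≤∣p∣ (outside ∷ p) = inj₁ (zero , refl)
outside⊎m≤∣p∣ (inside ∷ p) with outside⊎m≤∣p∣ p
... | inj₁ (i , pᵢ) = inj₁ (suc i , pᵢ)
... | inj₂ m≤∣p∣ = inj₂ (s≤s m≤∣p∣)

twoOutside⊎m≤1+∣p∣ : ∀ {m} (p : Subset m) →
  (∃ λ i → ∃ λ j → i ≢ j × lookup p i ≡ false × lookup p j ≡ false) ⊎ m ≤ suc ∣ p ∣
twoOutside⊎m≤1+∣p∣ [] = inj₂ z≤n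
twoOutside⊎m≤1+∣p∣ (inside ∷ p) with twoOutside⊎m≤1+∣p∣ p
... | inj₁ (i , j , i≢j , pᵢ , pⱼ) = inj₁ (suc i , suc j , i≢j ∘ suc-injective , pᵢ , pⱼ)
... | inj₂ m≤1+∣p∣ = inj₂ (s≤s m≤1+∣p∣)
twoOutside⊎m≤1+∣p∣ (outside ∷ p) with outside⊎m≤∣p∣ p
... | inj₁ (j , pⱼ) = inj₁ (zero , suc j , (λ ()) , refl , pⱼ)
... | inj₂ m≤∣p∣ = inj₂ (s≤s m≤∣p∣)

module _ (G : Graph) where

  lookup-I : ∀ C u w → lookup (I G C u) w ≡ (does (w ≟ u) ∨ adj G u w) ∧ lookup C w
  lookup-I C u w = begin
    lookup (I G C u) w                              ≡⟨ lookup∘tabulate _ w ⟩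
    lookup (N[ G ] u) w ∧ lookup C w                ≡⟨ cong (_∧ lookup C w) (lookup∘tabulate _ w) ⟩
    (does (w ≟ u) ∨ adj G u w) ∧ lookup C w         ∎
    where open ≡-Reasoning

  I-cong : ∀ C u v → (∀ w → (does (w ≟ u) ∨ adj G u w) ∧ lookup C w ≡ (does (w ≟ v) ∨ adj G v w) ∧ lookup C w) →
           I G C u ≡ I G C v
  I-cong C u v eq = ≗⇒≡ λ w → trans (lookup-I C u w) (trans (eq w) (sym (lookup-I C v w)))

  I≡⊥ : ∀ C u → (∀ w → (does (w ≟ u) ∨ adj G u w) ∧ lookup C w ≡ false) → I G C u ≡ ⊥
  I≡⊥ C u empty = ≗⇒≡ λ w → trans (lookup-I C u w) (trans (empty w) (sym (lookup-replicate w false)))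

  Separates : Subset (order G) → Fin (order G) → Fin (order G) → Set
  Separates C u v = ∃ λ w → lookup (I G C u) w ≡ true × lookup (I G C v) w ≡ false

  separates⇒I≢ : ∀ C u v → Separates C u v ⊎ Separates C v u → I G C u ≢ I G C v
  separates⇒I≢ _ _ _ (inj₁ (w , uw , vw)) = lookup-true-false⇒≢ w uw vw
  separates⇒I≢ _ _ _ (inj₂ (w , vw , uw)) = lookup-true-false⇒≢ w vw uw ∘ sym

  identifying⇒locatingDominating : ∀ {C} → IsIdentifying G C → IsLocatingDominating G C
  identifying⇒locatingDominating (cov , sep) = cov , λ u v u≢v _ _ → sep u v u≢v

  localIdentifying⇒localLocatingDominating : ∀ {C} → IsLocalIdentifying G C → IsLocalLocatingDominating G C
  localIdentifying⇒localLocatingDominating (cov , sep) = cov , λ u v uv _ _ → sep u v uv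

pattern a₀ = zero
pattern a₁ = suc zero
pattern b i = suc (suc i)

module _ (n : ℕ) where

  a-twins : ∀ (cs : Subset n) → I (K2 n) (outside ∷ outside ∷ cs) a₀ ≡ I (K2 n) (outside ∷ outside ∷ cs) a₁
  a-twins cs = I-cong (K2 n) (outside ∷ outside ∷ cs) a₀ a₁ λ { a₀ → refl ; a₁ → refl ; (b _) → refl }

  b-twins : ∀ ca cb (cs : Subset n) {i j} → lookup cs i ≡ false → lookup cs j ≡ false →
            I (K2 n) (ca ∷ cb ∷ cs) (b i) ≡ I (K2 n) (ca ∷ cb ∷ cs) (b j)
  b-twins ca cb cs csᵢ csⱼ = I-cong (K2 n) (ca ∷ cb ∷ cs) (b _) (b _) λ
    { a₀ → refl ; a₁ → refl ; (b k) → trans (⁅i⁆∩p≡∅ cs csᵢ k) (sym (⁅i⁆∩p≡∅ cs csⱼ k)) }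

  locatingDominating⇒n≤∣C∣ : ∀ C → IsLocatingDominating (K2 n) C → n ≤ ∣ C ∣
  locatingDominating⇒n≤∣C∣ (ca ∷ cb ∷ cs) (_ , sep) with twoOutside⊎m≤1+∣p∣ cs
  ... | inj₁ (i , j , i≢j , csᵢ , csⱼ) = ⊥-elim
    (sep (b i) (b j) (i≢j ∘ suc-injective ∘ suc-injective)
         (lookup-false⇒∉ csᵢ) (lookup-false⇒∉ csⱼ) (b-twins ca cb cs csᵢ csⱼ))
  locatingDominating⇒n≤∣C∣ (inside ∷ cb ∷ cs) _ | inj₂ n≤1+∣cs∣ = ≤-trans n≤1+∣cs∣ (s≤s (∣p∣≤∣x∷p∣ cb cs))
  locatingDominating⇒n≤∣C∣ (outside ∷ inside ∷ cs) _ | inj₂ n≤1+∣cs∣ = n≤1+∣cs∣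
  locatingDominating⇒n≤∣C∣ (outside ∷ outside ∷ cs) (_ , sep) | inj₂ _ =
    ⊥-elim (sep a₀ a₁ (λ ()) (λ ()) (λ { (there ()) }) (a-twins cs))

  covering⇒2≤∣C∣ : 2 ≤ n → ∀ C → IsCovering (K2 n) C → 2 ≤ ∣ C ∣
  covering⇒2≤∣C∣ _ (inside ∷ inside ∷ _) _ = s≤s (s≤s z≤n)
  covering⇒2≤∣C∣ _ (inside ∷ outside ∷ cs) (_ , cov) with allOutside⊎1≤∣p∣ cs
  ... | inj₁ cs≡∅ = ⊥-elim (cov a₁ (I≡⊥ (K2 n) (inside ∷ outside ∷ cs) a₁ λ { a₀ → refl ; a₁ → refl ; (b k) → cs≡∅ k }))
  ... | inj₂ 1≤∣cs∣ = s≤s 1≤∣cs∣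
  covering⇒2≤∣C∣ _ (outside ∷ inside ∷ cs) (_ , cov) with allOutside⊎1≤∣p∣ cs
  ... | inj₁ cs≡∅ = ⊥-elim (cov a₀ (I≡⊥ (K2 n) (outside ∷ inside ∷ cs) a₀ λ { a₀ → refl ; a₁ → refl ; (b k) → cs≡∅ k }))
  ... | inj₂ 1≤∣cs∣ = s≤s 1≤∣cs∣
  covering⇒2≤∣C∣ 2≤n (outside ∷ outside ∷ cs) (_ , cov) with outside⊎m≤∣p∣ cs
  ... | inj₁ (k , csₖ) = ⊥-elim (cov (b k)
          (I≡⊥ (K2 n) (outside ∷ outside ∷ cs) (b k) λ { a₀ → refl ; a₁ → refl ; (b j) → ⁅i⁆∩p≡∅ cs csₖ j }))
  ... | inj₂ n≤∣cs∣ = ≤-trans 2≤n n≤∣cs∣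

  partA : Subset (2 + n)
  partA = inside ∷ inside ∷ ⊥

  partA-localIdentifying : IsLocalIdentifying (K2 n) partA
  partA-localIdentifying = ((a₀ , here) , covers) , λ u v uv → separates⇒I≢ (K2 n) partA u v (separates u v uv)
    where
    covers : ∀ u → I (K2 n) partA u ≢ ⊥
    covers a₀ = lookup-true⇒≢⊥ a₀ refl
    covers a₁ = lookup-true⇒≢⊥ a₁ refl
    covers (b _) = lookup-true⇒≢⊥ a₀ refl

    separates : ∀ u v → adj (K2 n) u v ≡ true →
                Separates (K2 n) partA u v ⊎ Separates (K2 n) partA v u
    separates a₀ (b _) _ = inj₂ (a₁ , refl , refl)
    separates a₁ (b _) _ = inj₂ (a₀ , refl , refl)
    separates (b _) a₀ _ = inj₁ (a₁ , refl , refl)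
    separates (b _) a₁ _ = inj₁ (a₀ , refl , refl)
    separates a₀ a₀ ()
    separates a₀ a₁ ()
    separates a₁ a₀ ()
    separates a₁ a₁ ()
    separates (b _) (b _) ()

  ∣partA∣≡2 : ∣ partA ∣ ≡ 2
  ∣partA∣≡2 = cong (2 +_) (∣⊥∣≡0 n)

module _ (m : ℕ) where
  private
    n : ℕ
    n = 3 + m

  identifyingCode : Subset (2 + n)
  identifyingCode = inside ∷ outside ∷ outside ∷ ⊤

  private
    D : Subset (2 + n)
    D = identifyingCode

    a₀∈I : ∀ u → u ≢ a₁ → lookup (I (K2 n) D u) a₀ ≡ true
    a₀∈I a₀ _ = refl
    a₀∈I a₁ a₁≢a₁ = ⊥-elim (a₁≢a₁ refl)
    a₀∈I (b _) _ = refl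

    lookup-I[b]-b : ∀ j k → lookup (I (K2 n) D (b (suc k))) (b (suc j)) ≡ does (j ≟ k)
    lookup-I[b]-b j k = begin
      lookup (I (K2 n) D (b (suc k))) (b (suc j)) ≡⟨ lookup-I (K2 n) D (b (suc k)) (b (suc j)) ⟩
      (does (j ≟ k) ∨ false) ∧ lookup ⊤ j       ≡⟨ cong₂ _∧_ (∨-identityʳ _) (lookup-replicate j true) ⟩
      does (j ≟ k) ∧ true                       ≡⟨ ∧-identityʳ _ ⟩
      does (j ≟ k)                              ∎
      where open ≡-Reasoning

    b∈I[b] : ∀ k → lookup (I (K2 n) D (b (suc k))) (b (suc k)) ≡ true
    b∈I[b] k = trans (lookup-I[b]-b k k) (dec-true (k ≟ k) refl)

    b∉I[b] : ∀ {j k} → j ≢ k → lookup (I (K2 n) D (b (suc k))) (b (suc j)) ≡ false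
    b∉I[b] {j} {k} j≢k = trans (lookup-I[b]-b j k) (dec-false (j ≟ k) j≢k)

    a₀-separates : ∀ i → Separates (K2 n) D a₀ (b i)
    a₀-separates zero = b (suc zero) , refl , refl
    a₀-separates (suc zero) = b (suc (suc zero)) , refl , refl
    a₀-separates (suc (suc _)) = b (suc zero) , refl , refl

    separates : ∀ u v → u ≢ v → Separates (K2 n) D u v ⊎ Separates (K2 n) D v u
    separates a₁ v a₁≢v = inj₂ (a₀ , a₀∈I v (a₁≢v ∘ sym) , refl)
    separates u a₁ u≢a₁ = inj₁ (a₀ , a₀∈I u u≢a₁ , refl)
    separates a₀ a₀ a₀≢a₀ = ⊥-elim (a₀≢a₀ refl)
    separates a₀ (b i) _ = inj₁ (a₀-separates i)
    separates (b i) a₀ _ = inj₂ (a₀-separates i)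
    separates (b zero) (b zero) b₀≢b₀ = ⊥-elim (b₀≢b₀ refl)
    separates (b zero) (b (suc k)) _ = inj₂ (b (suc k) , b∈I[b] k , lookup-I (K2 n) D (b zero) (b (suc k)))
    separates (b (suc k)) (b zero) _ = inj₁ (b (suc k) , b∈I[b] k , lookup-I (K2 n) D (b zero) (b (suc k)))
    separates (b (suc k)) (b (suc j)) k≢j = inj₁ (b (suc k) , b∈I[b] k , b∉I[b] {k} {j} λ { refl → k≢j refl })

  identifyingCode-identifying : IsIdentifying (K2 n) identifyingCode
  identifyingCode-identifying = ((a₀ , here) , covers) , λ u v u≢v → separates⇒I≢ (K2 n) D u v (separates u v u≢v)
    where
    covers : ∀ u → I (K2 n) D u ≢ ⊥
    covers a₀ = lookup-true⇒≢⊥ a₀ refl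
    covers a₁ = lookup-true⇒≢⊥ (b (suc zero)) refl
    covers (b _) = lookup-true⇒≢⊥ a₀ refl

  ∣identifyingCode∣≡n : ∣ identifyingCode ∣ ≡ n
  ∣identifyingCode∣≡n = cong suc (∣⊤∣≡n (2 + m))

mainTheorem10 : (n : ℕ) → 3 ≤ n →
    IsMinCard (K2 n) (IsIdentifying (K2 n)) n
    × IsMinCard (K2 n) (IsLocatingDominating (K2 n)) n
    × IsMinCard (K2 n) (IsLocalIdentifying (K2 n)) 2
    × IsMinCard (K2 n) (IsLocalLocatingDominating (K2 n)) 2
mainTheorem10 n@(suc (suc (suc m))) (s≤s (s≤s (s≤s _))) =
    ((identifyingCode m , identifying , ∣identifyingCode∣≡n m) ,
      λ C → locatingDominating⇒n≤∣C∣ n C ∘ identifying⇒locatingDominating (K2 n))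
  , ((identifyingCode m , identifying⇒locatingDominating (K2 n) identifying , ∣identifyingCode∣≡n m) ,
      locatingDominating⇒n≤∣C∣ n)
  , ((partA n , localIdentifying , ∣partA∣≡2 n) , λ C → covering⇒2≤∣C∣ n 2≤n C ∘ proj₁)
  , ((partA n , localIdentifying⇒localLocatingDominating (K2 n) localIdentifying , ∣partA∣≡2 n) ,
      λ C → covering⇒2≤∣C∣ n 2≤n C ∘ proj₁)
  where
  identifying : IsIdentifying (K2 n) (identifyingCode m)
  identifying = identifyingCode-identifying m

  localIdentifying : IsLocalIdentifying (K2 n) (partA n)
  localIdentifying = partA-localIdentifying n

  2≤n : 2 ≤ n
  2≤n = s≤s (s≤s z≤n)
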